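{- Let $H$ be a graph of radius $r(H)\ge 4$. Then the vertex of $K_1$ does not belong to any local metric basis for $K_1+H$.
   Context: All graphs are finite and simple. For a connected graph $X$, $d_X(x,y)$ is the length of a shortest path between $x$ and $y$. A vertex $w$ distinguishes two vertices $x,y$ if $d_X(w,x)\ne d_X(w,y)$. A set $S\subseteq V(X)$ is a local metric generator for $X$ if every two adjacent vertices of $X$ are distinguished by some vertex of $S$; a local metric generator of minimum cardinality is a local metric basis. The join $K_1+H$ is obtained from $H$ by adding one new vertex (the vertex of $K_1$) adjacent to every vertex of $H$. The radius $r(H)$ is the minimum eccentricity of a vertex of $H$. -}

module Defs where

open import Data.Nat using (ℕ; zero; suc; _≤_)
open import Data.Fin using (Fin) renaming (zero to fzero; suc to fsuc)
open import Data.Fin.Subset using (Subset; _∈_; ∣_∣)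
open import Data.Product using (Σ; ∃; ∃-syntax; _×_; _,_)
open import Data.Empty using (⊥)
open import Data.Unit using (⊤; tt)
open import Relation.Nullary using (¬_; yes; no)
open import Relation.Binary using (Decidable)
open import Relation.Binary.PropositionalEquality using (_≢_)

record Graph (n : ℕ) : Set₁ where
  field
    _~_    : Fin n → Fin n → Set
    ~-sym  : ∀ {x y} → x ~ y → y ~ x
    ~-irr  : ∀ {x} → ¬ (x ~ x)
    ~-dec  : Decidable _~_
open Graph public

data Walk {n : ℕ} (G : Graph n) : Fin n → Fin n → ℕ → Set where
  here : ∀ {x} → Walk G x x 0
  step : ∀ {x z y k} → _~_ G x z → Walk G z y k → Walk G x y (suc k)

Connected : ∀ {n} → Graph n → Set
Connected G = ∀ x y → ∃[ k ] Walk G x y k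

Dist : ∀ {n} → Graph n → Fin n → Fin n → ℕ → Set
Dist G x y k = Walk G x y k × (∀ m → Walk G x y m → k ≤ m)

Ecc : ∀ {n} → Graph n → Fin n → ℕ → Set
Ecc G x e = (∃[ y ] Dist G x y e) × (∀ y k → Dist G x y k → k ≤ e)

Radius : ∀ {n} → Graph n → ℕ → Set
Radius G r = (∃[ x ] Ecc G x r) × (∀ x e → Ecc G x e → r ≤ e)

Distinguishes : ∀ {n} → Graph n → Fin n → Fin n → Fin n → Set
Distinguishes G w x y = ∃[ k ] ∃[ l ] (Dist G w x k × Dist G w y l × k ≢ l)

LocalMetricGenerator : ∀ {n} → Graph n → Subset n → Set
LocalMetricGenerator G S =
  ∀ x y → _~_ G x y → ∃[ w ] (w ∈ S × Distinguishes G w x y)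

LocalMetricBasis : ∀ {n} → Graph n → Subset n → Set
LocalMetricBasis {n} G S =
  LocalMetricGenerator G S × (∀ (T : Subset n) → LocalMetricGenerator G T → ∣ S ∣ ≤ ∣ T ∣)

-- The join K₁ + H on Fin (suc n): vertex fzero is the vertex of K₁,
-- vertex fsuc i is the vertex i of H.
joinAdj : ∀ {n} → Graph n → Fin (suc n) → Fin (suc n) → Set
joinAdj H fzero    fzero    = ⊥
joinAdj H fzero    (fsuc j) = ⊤
joinAdj H (fsuc i) fzero    = ⊤
joinAdj H (fsuc i) (fsuc j) = _~_ H i j

joinSym : ∀ {n} (H : Graph n) {x y} → joinAdj H x y → joinAdj H y x
joinSym H {fzero}  {fsuc j} p = tt
joinSym H {fsuc i} {fzero}  p = tt
joinSym H {fsuc i} {fsuc j} p = ~-sym H p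

joinIrr : ∀ {n} (H : Graph n) {x} → ¬ joinAdj H x x
joinIrr H {fzero}  ()
joinIrr H {fsuc i} p = ~-irr H p

joinDec : ∀ {n} (H : Graph n) → Decidable (joinAdj H)
joinDec H fzero    fzero    = no (λ ())
joinDec H fzero    (fsuc j) = yes tt
joinDec H (fsuc i) fzero    = yes tt
joinDec H (fsuc i) (fsuc j) = ~-dec H i j

K₁+_ : ∀ {n} → Graph n → Graph (suc n)
K₁+ H = record
  { _~_   = joinAdj H
  ; ~-sym = λ {x} {y} → joinSym H {x} {y}
  ; ~-irr = λ {x} → joinIrr H {x}
  ; ~-dec = joinDec H
  }

module Submission where

open import Defs
open import Data.Nat using (ℕ; suc; _≤_)
open import Data.Fin using (Fin) renaming (zero to fzero)
open import Data.Fin.Subset using (Subset; _∉_)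
open import Data.Product using (∃-syntax; _×_)

open import Data.Nat using (zero; _<_; z≤n; s≤s)
open import Data.Nat.Properties
  using (≤-antisym; ≤-refl; ≤-trans; <⇒≤; ≮⇒≥; <-irrefl; ≤⇒≯; m≤n⇒m≤1+n; ≤-totalOrder; anyUpTo?)
open import Data.Nat.Induction using (<-rec)
open import Data.Fin using (_≟_) renaming (suc to fsuc)
open import Data.Fin.Properties using (any?)
open import Data.Fin.Subset using (_∈_; inside; outside)
open import Data.Fin.Subset.Properties using (_∈?_)
open import Data.Vec using (_∷_; here; there)
open import Data.List using (allFin)
open import Data.List.Relation.Unary.All using (lookup)
open import Data.List.Membership.Propositional.Properties using (∈-allFin)
open import Data.List.Extrema ≤-totalOrder using (argmax; f[xs]≤f[argmax])
open import Data.Product using (_,_; proj₁; proj₂)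
open import Data.Sum using (_⊎_; inj₁; inj₂)
open import Data.Empty using (⊥-elim)
open import Data.Unit using (tt)
open import Relation.Nullary using (¬_; Dec; yes; no)
open import Relation.Nullary.Decidable using (_×-dec_; _⊎-dec_; ¬?)
open import Relation.Binary.PropositionalEquality using (_≡_; refl; sym; trans; subst; _≢_)

-- In K₁ + H the apex is adjacent to everything, so H-vertices are pairwise at
-- distance at most 2 and the apex distinguishes no two of them.  Hence if S is a
-- local metric basis containing the apex, S without the apex still resolves every
-- edge of H, and the only edges it can fail on are apex–i ones: this happens only
-- when every other vertex of S is a neighbour of i.  But then every edge of H has
-- an endpoint within distance 2 of i, so by connectivity every vertex of H is
-- within distance 3 of i, contradicting r(H) ≥ 4.  So S without the apex would be
-- a smaller local metric generator.

LeastAtMost : (ℕ → Set) → ℕ → Set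
LeastAtMost P k = ∃[ m ] (P m × m ≤ k × (∀ j → P j → m ≤ j))

least : {P : ℕ → Set} → (∀ m → Dec (P m)) → ∀ k → P k → LeastAtMost P k
least {P} P? = <-rec (λ k → P k → LeastAtMost P k) go
  where
    go : ∀ k → (∀ {j} → j < k → P j → LeastAtMost P j) → P k → LeastAtMost P k
    go k rec pk with anyUpTo? P? k
    ... | yes (j , j<k , pj) with rec j<k pj
    ...   | m , pm , m≤j , minimal = m , pm , ≤-trans m≤j (<⇒≤ j<k) , minimal
    go k rec pk | no nothingBelow =
      k , pk , ≤-refl , λ j pj → ≮⇒≥ (λ j<k → nothingBelow (j , j<k , pj))

module _ {n} {G : Graph n} where

  walk₀⇒≡ : ∀ {x y} → Walk G x y 0 → x ≡ y
  walk₀⇒≡ here = refl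

  walk₁⇒adjacent : ∀ {x y} → Walk G x y 1 → _~_ G x y
  walk₁⇒adjacent (step x~y here) = x~y

  dist-unique : ∀ {x y k l} → Dist G x y k → Dist G x y l → k ≡ l
  dist-unique (wk , k≤) (wl , l≤) = ≤-antisym (k≤ _ wl) (l≤ _ wk)

  walk? : ∀ m x y → Dec (Walk G x y m)
  walk? zero x y with x ≟ y
  ... | yes refl = yes here
  ... | no x≢y = no (λ w → x≢y (walk₀⇒≡ w))
  walk? (suc m) x y with any? (λ z → ~-dec G x z ×-dec walk? m z y)
  ... | yes (z , x~z , w) = yes (step x~z w)
  ... | no noStep = no (λ { (step x~z w) → noStep (_ , x~z , w) })

  walk⇒dist : ∀ {x y k} → Walk G x y k → ∃[ m ] (Dist G x y m × m ≤ k)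
  walk⇒dist {x} {y} {k} w with least (λ m → walk? m x y) k w
  ... | m , wm , m≤k , minimal = m , (wm , minimal) , m≤k

  WalkWithin : ℕ → Fin n → Fin n → Set
  WalkWithin b x y = ∃[ m ] (m ≤ b × Walk G x y m)

  walkWithin-refl : ∀ {b x} → WalkWithin b x x
  walkWithin-refl = 0 , z≤n , here

  walkWithin-weaken : ∀ {b x y} → WalkWithin b x y → WalkWithin (suc b) x y
  walkWithin-weaken (m , m≤b , w) = m , m≤n⇒m≤1+n m≤b , w

  walk-snoc : ∀ {x y z m} → Walk G x y m → _~_ G y z → Walk G x z (suc m)
  walk-snoc here y~z = step y~z here
  walk-snoc (step x~u w) y~z = step x~u (walk-snoc w y~z)

  walkWithin-snoc : ∀ {b x y z} → WalkWithin b x y → _~_ G y z → WalkWithin (suc b) x z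
  walkWithin-snoc (m , m≤b , w) y~z = suc m , s≤s m≤b , walk-snoc w y~z

  walkWithin⇒dist : ∀ {b x y} → WalkWithin b x y → ∃[ m ] (Dist G x y m × m ≤ b)
  walkWithin⇒dist (k , k≤b , w) with walk⇒dist w
  ... | m , dm , m≤k = m , dm , ≤-trans m≤k k≤b

  -- ecc≤ takes the distances as a hypothesis, and radius≤ uses let rather than with,
  -- so that conversion checking never unfolds walk⇒dist (which is very expensive).
  ecc≤ : ∀ {b} x → (∀ y → ∃[ m ] (Dist G x y m × m ≤ b)) → ∃[ e ] (Ecc G x e × e ≤ b)
  ecc≤ {b} x distances = d far , ((far , dist far) , farthest) , proj₂ (proj₂ (distances far))
    where
      d : Fin n → ℕ
      d y = proj₁ (distances y)

      dist : ∀ y → Dist G x y (d y)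
      dist y = proj₁ (proj₂ (distances y))

      far : Fin n
      far = argmax d x (allFin n)

      farthest : ∀ y k → Dist G x y k → k ≤ d far
      farthest y k dk =
        subst (_≤ d far) (dist-unique (dist y) dk) (lookup (f[xs]≤f[argmax] {f = d} x (allFin n)) (∈-allFin y))

  radius≤ : ∀ {r b} x → Radius G r → (∀ y → WalkWithin b x y) → r ≤ b
  radius≤ x (_ , minimal) within =
    let e , ecc , e≤b = ecc≤ x (λ y → walkWithin⇒dist (within y)) in ≤-trans (minimal x e ecc) e≤b

  edgesWithin⇒verticesWithin : ∀ {b i} → Connected G →
    (∀ u v → _~_ G u v → WalkWithin b i u ⊎ WalkWithin b i v) → ∀ y → WalkWithin (suc b) i y
  edgesWithin⇒verticesWithin {b} {i} connected near y = along (proj₂ (connected i y)) walkWithin-refl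
    where
      along : ∀ {v k} → Walk G v y k → WalkWithin (suc b) i v → WalkWithin (suc b) i y
      along here iv = iv
      along (step {z = z} v~z w) iv with near _ z v~z
      ... | inj₁ near-v = along w (walkWithin-snoc near-v v~z)
      ... | inj₂ near-z = along w (walkWithin-weaken near-z)

module Join {n} (H : Graph n) where

  G : Graph (suc n)
  G = K₁+ H

  ClosedNeighbour : Fin n → Fin n → Set
  ClosedNeighbour c a = c ≡ a ⊎ _~_ H c a

  dist-refl : ∀ x → Dist G x x 0
  dist-refl x = here , λ _ _ → z≤n

  dist-adjacent : ∀ {x y} → _~_ G x y → Dist G x y 1
  dist-adjacent {x} x~y = step x~y here , atLeast1
    where
      atLeast1 : ∀ m → Walk G x _ m → 1 ≤ m
      atLeast1 zero w with walk₀⇒≡ w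
      ... | refl = ⊥-elim (~-irr G {x} x~y)
      atLeast1 (suc m) _ = s≤s z≤n

  dist-nonadjacent : ∀ {c a} → c ≢ a → ¬ _~_ H c a → Dist G (fsuc c) (fsuc a) 2
  dist-nonadjacent c≢a c≁a = step {z = fzero} tt (step tt here) , atLeast2
    where
      atLeast2 : ∀ m → Walk G _ _ m → 2 ≤ m
      atLeast2 zero w with walk₀⇒≡ w
      ... | refl = ⊥-elim (c≢a refl)
      atLeast2 (suc zero) w = ⊥-elim (c≁a (walk₁⇒adjacent w))
      atLeast2 (suc (suc m)) _ = s≤s (s≤s z≤n)

  distinguishes-sym : ∀ {w x y} → Distinguishes G w x y → Distinguishes G w y x
  distinguishes-sym (k , l , dk , dl , k≢l) = l , k , dl , dk , λ l≡k → k≢l (sym l≡k)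

  apex-¬distinguishes : ∀ {a b} → ¬ Distinguishes G fzero (fsuc a) (fsuc b)
  apex-¬distinguishes (k , l , dk , dl , k≢l) =
    k≢l (trans (dist-unique dk (dist-adjacent tt)) (sym (dist-unique dl (dist-adjacent tt))))

  distinguishes⇒closedNeighbour : ∀ {c a b} → Distinguishes G (fsuc c) (fsuc a) (fsuc b) →
    ClosedNeighbour c a ⊎ ClosedNeighbour c b
  distinguishes⇒closedNeighbour {c} {a} {b} (k , l , dk , dl , k≢l)
    with c ≟ a | ~-dec H c a | c ≟ b | ~-dec H c b
  ... | yes c≡a | _ | _ | _ = inj₁ (inj₁ c≡a)
  ... | _ | yes c~a | _ | _ = inj₁ (inj₂ c~a)
  ... | _ | _ | yes c≡b | _ = inj₂ (inj₁ c≡b)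
  ... | _ | _ | _ | yes c~b = inj₂ (inj₂ c~b)
  ... | no c≢a | no c≁a | no c≢b | no c≁b =
    ⊥-elim (k≢l (trans (dist-unique dk (dist-nonadjacent c≢a c≁a))
                       (sym (dist-unique dl (dist-nonadjacent c≢b c≁b)))))

  distinguishes-apex : ∀ {c i} → c ≡ i ⊎ ¬ _~_ H c i → Distinguishes G (fsuc c) fzero (fsuc i)
  distinguishes-apex (inj₁ refl) = 1 , 0 , dist-adjacent tt , dist-refl _ , λ ()
  distinguishes-apex {c} {i} (inj₂ c≁i) with c ≟ i
  ... | yes refl = 1 , 0 , dist-adjacent tt , dist-refl _ , λ ()
  ... | no c≢i = 1 , 2 , dist-adjacent tt , dist-nonadjacent c≢i c≁i , λ ()

  closedNeighbour⇒within2 : ∀ {i c a} → _~_ H i c → ClosedNeighbour c a → WalkWithin {G = H} 2 i a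
  closedNeighbour⇒within2 i~c (inj₁ refl) = 1 , s≤s z≤n , step i~c here
  closedNeighbour⇒within2 i~c (inj₂ c~a) = 2 , ≤-refl , step i~c (step c~a here)

  module _ (T : Subset n) (generates : LocalMetricGenerator G (inside ∷ T)) where

    resolves-H-edge : ∀ {a b} → _~_ H a b →
      ∃[ c ] (c ∈ T × Distinguishes G (fsuc c) (fsuc a) (fsuc b))
    resolves-H-edge {a} {b} a~b with generates (fsuc a) (fsuc b) a~b
    ... | fzero , _ , apexDistinguishes = ⊥-elim (apex-¬distinguishes apexDistinguishes)
    ... | fsuc c , there c∈T , cDistinguishes = c , c∈T , cDistinguishes

    ⊆neighbours⇒radius≤3 : ∀ {r i} → Connected H → Radius H r → (∀ c → c ∈ T → _~_ H i c) → r ≤ 3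
    ⊆neighbours⇒radius≤3 {i = i} connected radius T⊆N[i] =
      radius≤ i radius (edgesWithin⇒verticesWithin connected near)
      where
        near : ∀ a b → _~_ H a b → WalkWithin 2 i a ⊎ WalkWithin 2 i b
        near a b a~b with resolves-H-edge a~b
        ... | c , c∈T , cDistinguishes with distinguishes⇒closedNeighbour cDistinguishes
        ...   | inj₁ ca = inj₁ (closedNeighbour⇒within2 (T⊆N[i] c c∈T) ca)
        ...   | inj₂ cb = inj₂ (closedNeighbour⇒within2 (T⊆N[i] c c∈T) cb)

    resolves-apex-edge : ∀ {r} → Connected H → Radius H r → 3 < r →
      ∀ i → ∃[ c ] (c ∈ T × Distinguishes G (fsuc c) fzero (fsuc i))
    resolves-apex-edge connected radius 3<r i
      with any? (λ c → (c ∈? T) ×-dec ((c ≟ i) ⊎-dec ¬? (~-dec H c i)))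
    ... | yes (c , c∈T , c≡i⊎c≁i) = c , c∈T , distinguishes-apex c≡i⊎c≁i
    ... | no none = ⊥-elim (≤⇒≯ (⊆neighbours⇒radius≤3 connected radius T⊆N[i]) 3<r)
      where
        T⊆N[i] : ∀ c → c ∈ T → _~_ H i c
        T⊆N[i] c c∈T with ~-dec H c i
        ... | yes c~i = ~-sym H c~i
        ... | no c≁i = ⊥-elim (none (c , c∈T , inj₂ c≁i))

    without-apex : ∀ {r} → Connected H → Radius H r → 3 < r → LocalMetricGenerator G (outside ∷ T)
    without-apex connected radius 3<r fzero (fsuc i) _ with resolves-apex-edge connected radius 3<r i
    ... | c , c∈T , d = fsuc c , there c∈T , d
    without-apex connected radius 3<r (fsuc i) fzero _ with resolves-apex-edge connected radius 3<r i
    ... | c , c∈T , d = fsuc c , there c∈T , distinguishes-sym d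
    without-apex connected radius 3<r (fsuc a) (fsuc b) a~b with resolves-H-edge a~b
    ... | c , c∈T , d = fsuc c , there c∈T , d

mainTheorem13 : ∀ {n : ℕ} (H : Graph n) → Connected H →
    (∃[ r ] (Radius H r × 4 ≤ r)) →
    ∀ (S : Subset (suc n)) → LocalMetricBasis (K₁+ H) S → fzero ∉ S
mainTheorem13 H connected (r , radius , 4≤r) (.inside ∷ T) (generates , minimum) here =
  <-irrefl refl (minimum (outside ∷ T) (Join.without-apex H T generates connected radius 4≤r))
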